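{- Let $k\ge 4$, $n=2k-1$, $\eta=(\eta_1<\dots<\eta_l)\in\mathbb{D}_k\setminus\{(3,k-3)\}$, let $Y_{2\eta^*}$ be the Young diagram whose main diagonal consists of exactly the $l+1$ cells $c_{1,1},\dots,c_{l+1,l+1}$ with $h_{1,1}=2n-4$, $h_{i,i}=2\eta_{l-(i-2)}$ ($2\le i\le l+1$) and $a(c_{i,i})=l(c_{i,i})+1$ ($1\le i\le l+1$), and let $\lambda$ be the partition whose parts are the hook lengths of the first-column cells of $Y_{2\eta^*}$. Then (1) $\lambda$ has exactly $n-2$ parts; (2) the largest part of $\lambda$ is $2n-4$; (3) the number of missing parts of $\lambda$ is $n-2$.
   Context: $\mathbb{D}_k$ is the set of partitions of $k$ into distinct parts with at least two parts. For a partition $\lambda$ into distinct parts with largest part $\lambda_t$, its missing parts are the elements of $\{1,\dots,\lambda_t\}\setminus\lambda$. Young diagrams in English convention; $c_{i,j}$ is the cell in row $i$, column $j$; arm $a$ = cells to the right, leg $l$ = cells below, $h_{i,j}=a+l+1$. -}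

module Defs where

open import Data.Nat using (ℕ; zero; suc; _+_; _*_; _∸_; _≤_; _<_; _≥_; _⊔_; _≤?_)
open import Data.Nat.ListAction using (sum)
open import Data.List using (List; []; _∷_; length; map; filter; foldr; _++_)
open import Data.List.Relation.Unary.All using (All)
open import Data.List.Relation.Unary.Linked using (Linked)
open import Data.List.Membership.DecPropositional (Data.Nat._≟_) using (_∉?_)
open import Data.Product using (_×_)
open import Relation.Binary.PropositionalEquality using (_≡_)

-- 1-indexed lookup with default 0 (entries beyond the list are 0).
nth : List ℕ → ℕ → ℕ
nth []       _             = 0
nth (x ∷ xs) zero          = 0
nth (x ∷ xs) (suc zero)    = x
nth (x ∷ xs) (suc (suc i)) = nth xs (suc i)

range1 : ℕ → List ℕ
range1 zero    = []
range1 (suc n) = range1 n ++ (suc n ∷ [])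

IsDistinctPartitionOf : ℕ → List ℕ → Set
IsDistinctPartitionOf k η = All (λ x → 1 ≤ x) η × Linked _<_ η × sum η ≡ k

InD : ℕ → List ℕ → Set
InD k η = IsDistinctPartitionOf k η × 2 ≤ length η

-- A Young diagram is given by its
-- list of row lengths μ = (μ₁ ≥ μ₂ ≥ ... > 0); row i has length nth μ i,
-- the cell c_{i,j} (1-indexed) belongs to the diagram iff 1 ≤ j ≤ nth μ i.

IsYoungDiagram : List ℕ → Set
IsYoungDiagram μ = All (λ x → 1 ≤ x) μ × Linked _≥_ μ

colLen : List ℕ → ℕ → ℕ
colLen μ j = length (filter (j ≤?_) μ)

arm : List ℕ → ℕ → ℕ → ℕ
arm μ i j = nth μ i ∸ j

leg : List ℕ → ℕ → ℕ → ℕ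
leg μ i j = colLen μ j ∸ i

hook : List ℕ → ℕ → ℕ → ℕ
hook μ i j = arm μ i j + leg μ i j + 1

diagLen : List ℕ → ℕ
diagLen μ = length (filter (λ i → i ≤? nth μ i) (range1 (length μ)))

firstColumnHooks : List ℕ → List ℕ
firstColumnHooks μ = map (λ i → hook μ i 1) (range1 (length μ))

largestPart : List ℕ → ℕ
largestPart = foldr _⊔_ 0

missingParts : List ℕ → List ℕ
missingParts λs = filter (_∉? λs) (range1 (largestPart λs))

{-# OPTIONS --safe #-}
-- Let r be the number of rows of μ. The condition a = l + 1 at c_{1,1} says the first row has
-- r + 1 cells, so h_{1,1} = 2r and therefore r = n − 2. The first-column hooks
-- h_{i,1} = μ_i + r − i strictly decrease, so they form a partition into r distinct parts with
-- largest part h_{1,1} = 2r; a partition into distinct parts with largest part N and t parts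
-- misses exactly N − t values, here 2r − r = r.
module Submission where

open import Defs
open import Data.Nat using (ℕ; zero; suc; _+_; _*_; _∸_; _⊔_; _≤_; _<_; _>_; _≥_; s≤s; s≤s⁻¹)
open import Data.Nat.Properties
open import Data.Nat.Tactic.RingSolver using (solve-∀)
open import Data.List using (List; []; _∷_; [_]; _++_; length; map; filter; applyUpTo)
open import Data.List.Properties
  using (length-++; length-map; map-cong; filter-++; filter-reject; filter-accept; filter-all;
         length-applyUpTo; applyUpTo-∷ʳ; map-applyUpTo)
open import Data.List.Relation.Unary.All as All using (All; []; _∷_)
open import Data.List.Relation.Unary.All.Properties using (All¬⇒¬Any)
open import Data.List.Relation.Unary.Any using (here; there)
open import Data.List.Relation.Unary.AllPairs as AllPairs using ()
open import Data.List.Relation.Unary.Linked as Linked using (Linked; []; [-]; _∷_)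
open import Data.List.Relation.Unary.Linked.Properties using (Linked⇒All; Linked⇒AllPairs)
open import Data.List.Membership.DecPropositional (Data.Nat._≟_) using (_∈_; _∉_; _∈?_; _∉?_)
open import Data.Product using (_×_; _,_)
open import Data.Sum using (_⊎_; inj₁; inj₂)
open import Data.Empty using (⊥-elim)
open import Function using (_∘_)
open import Relation.Nullary using (¬_; yes; no)
open import Relation.Binary.PropositionalEquality using (_≡_; refl; sym; trans; cong; subst; module ≡-Reasoning)
open ≡-Reasoning

>-trans : ∀ {i j k : ℕ} → i > j → j > k → i > k
>-trans i>j j>k = <-trans j>k i>j

below-head : ∀ {x xs} → Linked _>_ (x ∷ xs) → All (_< x) xs
below-head = AllPairs.head ∘ Linked⇒AllPairs >-trans

largestPart-head : ∀ {x xs} → Linked _>_ (x ∷ xs) → largestPart (x ∷ xs) ≡ x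
largestPart-head {x} [-]      = ⊔-identityʳ x
largestPart-head {x} (x>y ∷ l) = trans (cong (x ⊔_) (largestPart-head l)) (m≥n⇒m⊔n≡m (<⇒≤ x>y))

-- missingParts L is #missingBelow L (largestPart L); the bound is freed for an induction on it.
#missingBelow : List ℕ → ℕ → ℕ
#missingBelow L N = length (filter (_∉? L) (range1 N))

#missingBelow-suc : ∀ L N →
  #missingBelow L (suc N) ≡ #missingBelow L N + length (filter (_∉? L) [ suc N ])
#missingBelow-suc L N =
  trans (cong length (filter-++ (_∉? L) (range1 N) [ suc N ])) (length-++ (filter (_∉? L) (range1 N)))

#missingBelow-suc-∈ : ∀ {L} N → suc N ∈ L → #missingBelow L (suc N) ≡ #missingBelow L N
#missingBelow-suc-∈ {L} N sN∈L = begin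
  #missingBelow L (suc N)                              ≡⟨ #missingBelow-suc L N ⟩
  #missingBelow L N + length (filter (_∉? L) [ suc N ]) ≡⟨ cong (λ xs → #missingBelow L N + length xs)
                                                               (filter-reject (_∉? L) (λ sN∉L → sN∉L sN∈L)) ⟩
  #missingBelow L N + 0                                ≡⟨ +-identityʳ _ ⟩
  #missingBelow L N                                    ∎

#missingBelow-suc-∉ : ∀ {L} N → suc N ∉ L → #missingBelow L (suc N) ≡ suc (#missingBelow L N)
#missingBelow-suc-∉ {L} N sN∉L = begin
  #missingBelow L (suc N)                              ≡⟨ #missingBelow-suc L N ⟩
  #missingBelow L N + length (filter (_∉? L) [ suc N ]) ≡⟨ cong (λ xs → #missingBelow L N + length xs)
                                                               (filter-accept (_∉? L) sN∉L) ⟩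
  #missingBelow L N + 1                                ≡⟨ +-comm _ 1 ⟩
  suc (#missingBelow L N)                              ∎

#missingBelow-suc-below : ∀ {L} N → All (_< suc N) L → #missingBelow L (suc N) ≡ suc (#missingBelow L N)
#missingBelow-suc-below N below = #missingBelow-suc-∉ N (All¬⇒¬Any (All.map >⇒≢ below))

#missingBelow-cons-above : ∀ {x xs} N → N < x → #missingBelow (x ∷ xs) N ≡ #missingBelow xs N
#missingBelow-cons-above zero    _ = refl
#missingBelow-cons-above {x} {xs} (suc N) sN<x with suc N ∈? xs
... | yes sN∈xs = begin
  #missingBelow (x ∷ xs) (suc N) ≡⟨ #missingBelow-suc-∈ N (there sN∈xs) ⟩
  #missingBelow (x ∷ xs) N       ≡⟨ #missingBelow-cons-above N (<-trans (n<1+n N) sN<x) ⟩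
  #missingBelow xs N             ≡⟨ #missingBelow-suc-∈ N sN∈xs ⟨
  #missingBelow xs (suc N)       ∎
... | no sN∉xs = begin
  #missingBelow (x ∷ xs) (suc N)  ≡⟨ #missingBelow-suc-∉ N sN∉x∷xs ⟩
  suc (#missingBelow (x ∷ xs) N)  ≡⟨ cong suc (#missingBelow-cons-above N (<-trans (n<1+n N) sN<x)) ⟩
  suc (#missingBelow xs N)        ≡⟨ #missingBelow-suc-∉ N sN∉xs ⟨
  #missingBelow xs (suc N)        ∎
  where
  sN∉x∷xs : suc N ∉ x ∷ xs
  sN∉x∷xs (here sN≡x)   = <-irrefl sN≡x sN<x
  sN∉x∷xs (there sN∈xs) = sN∉xs sN∈xs

#missingBelow+length : ∀ N {L} → Linked _>_ L → All (1 ≤_) L → All (_≤ N) L →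
  #missingBelow L N + length L ≡ N
#missingBelow+length zero    {[]}     _ _           _ = refl
#missingBelow+length zero    {x ∷ _}  _ (s≤s _ ∷ _) (() ∷ _)
#missingBelow+length (suc N) {[]}     _ _           _ =
  trans (cong (_+ 0) (#missingBelow-suc-below N [])) (cong suc (#missingBelow+length N [] [] []))
#missingBelow+length (suc N) {x ∷ xs} desc pos (x≤sN ∷ _) with m≤n⇒m<n∨m≡n x≤sN
... | inj₁ x<sN = trans (cong (_+ _) (#missingBelow-suc-below N below))
                        (cong suc (#missingBelow+length N desc pos (All.map s≤s⁻¹ below)))
  where
  below : All (_< suc N) (x ∷ xs)
  below = Linked⇒All >-trans x<sN desc
... | inj₂ refl = begin
  #missingBelow (suc N ∷ xs) (suc N) + suc (length xs) ≡⟨ cong (_+ _) (#missingBelow-suc-∈ N (here refl)) ⟩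
  #missingBelow (suc N ∷ xs) N + suc (length xs)       ≡⟨ cong (_+ _) (#missingBelow-cons-above N (n<1+n N)) ⟩
  #missingBelow xs N + suc (length xs)                 ≡⟨ +-suc _ _ ⟩
  suc (#missingBelow xs N + length xs)                 ≡⟨ cong suc (#missingBelow+length N (Linked.tail desc) (All.tail pos)
                                                                      (All.map s≤s⁻¹ (below-head desc))) ⟩
  suc N                                                ∎

missingParts-length : ∀ {L} → Linked _>_ L → All (1 ≤_) L → length (missingParts L) + length L ≡ largestPart L
missingParts-length {[]}     _   _   = refl
missingParts-length {x ∷ xs} desc pos =
  subst (λ N → #missingBelow (x ∷ xs) N + length (x ∷ xs) ≡ N) (sym (largestPart-head desc))
        (#missingBelow+length x desc pos (≤-refl ∷ All.map <⇒≤ (below-head desc)))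

range1≡applyUpTo-suc : ∀ n → range1 n ≡ applyUpTo suc n
range1≡applyUpTo-suc zero    = refl
range1≡applyUpTo-suc (suc n) = trans (cong (_++ [ suc n ]) (range1≡applyUpTo-suc n)) (applyUpTo-∷ʳ suc n)

length-firstColumnHooks : ∀ μ → length (firstColumnHooks μ) ≡ length μ
length-firstColumnHooks μ = begin
  length (firstColumnHooks μ)          ≡⟨ length-map _ (range1 (length μ)) ⟩
  length (range1 (length μ))           ≡⟨ cong length (range1≡applyUpTo-suc (length μ)) ⟩
  length (applyUpTo suc (length μ))    ≡⟨ length-applyUpTo suc (length μ) ⟩
  length μ                             ∎

colLen-1 : ∀ {μ} → All (1 ≤_) μ → colLen μ 1 ≡ length μ
colLen-1 pos = cong length (filter-all (1 ≤?_) pos)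

-- The hook of c_{i,1} once the first column is known to meet every row; unlike hook, it satisfies
-- hook₁ (x ∷ xs) (2 + j) = hook₁ xs (1 + j) definitionally.
hook₁ : List ℕ → ℕ → ℕ
hook₁ μ i = arm μ i 1 + (length μ ∸ i) + 1

firstColumnHooks′ : List ℕ → List ℕ
firstColumnHooks′ []       = []
firstColumnHooks′ (x ∷ xs) = x ∸ 1 + length xs + 1 ∷ firstColumnHooks′ xs

applyUpTo-hook₁ : ∀ μ → applyUpTo (hook₁ μ ∘ suc) (length μ) ≡ firstColumnHooks′ μ
applyUpTo-hook₁ []       = refl
applyUpTo-hook₁ (x ∷ xs) = cong (x ∸ 1 + length xs + 1 ∷_) (applyUpTo-hook₁ xs)

firstColumnHooks≡firstColumnHooks′ : ∀ {μ} → All (1 ≤_) μ → firstColumnHooks μ ≡ firstColumnHooks′ μ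
firstColumnHooks≡firstColumnHooks′ {μ} pos = begin
  map (λ i → hook μ i 1) (range1 (length μ)) ≡⟨ map-cong (λ i → cong (λ c → arm μ i 1 + (c ∸ i) + 1) (colLen-1 pos)) _ ⟩
  map (hook₁ μ) (range1 (length μ))          ≡⟨ cong (map (hook₁ μ)) (range1≡applyUpTo-suc (length μ)) ⟩
  map (hook₁ μ) (applyUpTo suc (length μ))   ≡⟨ map-applyUpTo suc (hook₁ μ) (length μ) ⟩
  applyUpTo (hook₁ μ ∘ suc) (length μ)       ≡⟨ applyUpTo-hook₁ μ ⟩
  firstColumnHooks′ μ                        ∎

firstColumnHooks′-decreasing : ∀ {μ} → Linked _≥_ μ → Linked _>_ (firstColumnHooks′ μ)
firstColumnHooks′-decreasing {[]}        []        = []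
firstColumnHooks′-decreasing {_ ∷ []}    [-]       = [-]
firstColumnHooks′-decreasing {_ ∷ _ ∷ ys} (x≥y ∷ l) =
  +-monoˡ-< 1 (+-mono-≤-< (∸-monoˡ-≤ 1 x≥y) (n<1+n (length ys))) ∷ firstColumnHooks′-decreasing l

firstColumnHooks′-positive : ∀ μ → All (1 ≤_) (firstColumnHooks′ μ)
firstColumnHooks′-positive []       = []
firstColumnHooks′-positive (x ∷ xs) = m≤n+m 1 _ ∷ firstColumnHooks′-positive xs

firstColumnHooks-decreasing : ∀ {μ} → IsYoungDiagram μ → Linked _>_ (firstColumnHooks μ)
firstColumnHooks-decreasing (pos , desc) =
  subst (Linked _>_) (sym (firstColumnHooks≡firstColumnHooks′ pos)) (firstColumnHooks′-decreasing desc)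

firstColumnHooks-positive : ∀ {μ} → All (1 ≤_) μ → All (1 ≤_) (firstColumnHooks μ)
firstColumnHooks-positive {μ} pos =
  subst (All (1 ≤_)) (sym (firstColumnHooks≡firstColumnHooks′ pos)) (firstColumnHooks′-positive μ)

largestPart-firstColumnHooks : ∀ {m ms} → IsYoungDiagram (m ∷ ms) →
  largestPart (firstColumnHooks (m ∷ ms)) ≡ hook (m ∷ ms) 1 1
largestPart-firstColumnHooks {m} {ms} (pos , desc) = begin
  largestPart (firstColumnHooks (m ∷ ms))  ≡⟨ cong largestPart (firstColumnHooks≡firstColumnHooks′ pos) ⟩
  largestPart (firstColumnHooks′ (m ∷ ms)) ≡⟨ largestPart-head (firstColumnHooks′-decreasing desc) ⟩
  m ∸ 1 + length ms + 1                    ≡⟨ cong (λ c → m ∸ 1 + (c ∸ 1) + 1) (colLen-1 pos) ⟨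
  hook (m ∷ ms) 1 1                        ∎

m+1+m+1≡2*[1+m] : ∀ m → m + 1 + m + 1 ≡ 2 * suc m
m+1+m+1≡2*[1+m] = solve-∀

hook-1-1≡2*length : ∀ {μ} → All (1 ≤_) μ → arm μ 1 1 ≡ leg μ 1 1 + 1 → hook μ 1 1 ≡ 2 * length μ
hook-1-1≡2*length {[]}     _   ()
hook-1-1≡2*length {m ∷ ms} pos balanced = begin
  hook (m ∷ ms) 1 1                           ≡⟨ cong (λ a → a + leg (m ∷ ms) 1 1 + 1) balanced ⟩
  leg (m ∷ ms) 1 1 + 1 + leg (m ∷ ms) 1 1 + 1 ≡⟨ cong (λ l → l + 1 + l + 1) (cong (_∸ 1) (colLen-1 pos)) ⟩
  length ms + 1 + length ms + 1               ≡⟨ m+1+m+1≡2*[1+m] (length ms) ⟩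
  2 * length (m ∷ ms)                         ∎

corollary3p16 : (k n : ℕ) → 4 ≤ k → n ≡ 2 * k ∸ 1 →
    (η : List ℕ) → InD k η →
    ¬ (η ≡ 3 ∷ (k ∸ 3) ∷ [] ⊎ η ≡ (k ∸ 3) ∷ 3 ∷ []) →
    (μ : List ℕ) → IsYoungDiagram μ →
    diagLen μ ≡ length η + 1 →
    hook μ 1 1 ≡ 2 * n ∸ 4 →
    (∀ i → 2 ≤ i → i ≤ length η + 1 → hook μ i i ≡ 2 * nth η (length η + 2 ∸ i)) →
    (∀ i → 1 ≤ i → i ≤ length η + 1 → arm μ i i ≡ leg μ i i + 1) →
    length (firstColumnHooks μ) ≡ n ∸ 2
      × largestPart (firstColumnHooks μ) ≡ 2 * n ∸ 4
      × length (missingParts (firstColumnHooks μ)) ≡ n ∸ 2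
corollary3p16 _ _ _ _ η _ _ [] _ _ _ _ balanced = ⊥-elim (0≢1+n (balanced 1 ≤-refl (m≤n+m 1 (length η))))
corollary3p16 _ n _ _ η _ _ μ@(_ ∷ _) young@(pos , _) _ h₁₁ _ balanced = rows , largest , missing
  where
  r : ℕ
  r = n ∸ 2
  2*n∸4≡2*r : 2 * n ∸ 4 ≡ 2 * r
  2*n∸4≡2*r = sym (*-distribˡ-∸ 2 n 2)
  rows : length (firstColumnHooks μ) ≡ r
  rows = trans (length-firstColumnHooks μ) (*-cancelˡ-≡ _ _ 2 (begin
    2 * length μ ≡⟨ hook-1-1≡2*length pos (balanced 1 ≤-refl (m≤n+m 1 (length η))) ⟨
    hook μ 1 1   ≡⟨ h₁₁ ⟩
    2 * n ∸ 4    ≡⟨ 2*n∸4≡2*r ⟩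
    2 * r        ∎))
  largest : largestPart (firstColumnHooks μ) ≡ 2 * n ∸ 4
  largest = trans (largestPart-firstColumnHooks young) h₁₁
  missing : length (missingParts (firstColumnHooks μ)) ≡ r
  missing = +-cancelʳ-≡ r _ r (begin
    length (missingParts (firstColumnHooks μ)) + r
      ≡⟨ cong (length (missingParts (firstColumnHooks μ)) +_) rows ⟨
    length (missingParts (firstColumnHooks μ)) + length (firstColumnHooks μ)
      ≡⟨ missingParts-length (firstColumnHooks-decreasing young) (firstColumnHooks-positive pos) ⟩
    largestPart (firstColumnHooks μ)
      ≡⟨ trans largest 2*n∸4≡2*r ⟩
    2 * r
      ≡⟨ cong (r +_) (+-identityʳ r) ⟩
    r + r ∎)
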